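{- Let $D$ be a diagram with $|G(D)|=0$ and let $T\in\mathrm{GKD}(D)$. (a) If $(r,c)\in T$ is an ordinary cell, then for every $\tilde T\in\mathrm{GKD}(D)$ with $\tilde T\prec T$, either $(r,c)\in\tilde T$ or $\langle r,c\rangle\in\tilde T$. (b) If $c,r_1,r_2\in\mathbb{Z}_{>0}$ with $r_1<r_2$ are such that $\langle r_1,c\rangle\in T$ and $(\tilde r,c)\in T$ for all $r_1<\tilde r\le r_2$, then $(r_2,c)\in\tilde T$ for all $\tilde T\preceq T$.
   Context: A diagram is a finite set of cells placed at positions $(r,c)\in\mathbb{Z}_{>0}\times\mathbb{Z}_{>0}$ ($r$ the row, counted from the bottom; $c$ the column), each position holding at most one cell; each cell is either an ordinary cell, written $(r,c)$, or a ghost cell, written $\langle r,c\rangle$. A position is empty if it holds no cell of either kind. $G(D)$ denotes the set of ghost cells of $D$. The ghost move at row $r$ of $D$, with result denoted $\mathcal{G}(D,r)$, is defined as follows: if row $r$ is empty, $\mathcal{G}(D,r)=D$. Otherwise let $c$ be the largest column of a cell in row $r$. If this rightmost cell is a ghost cell, or there is no empty position $(\hat r,c)$ with $\hat r<r$, or, letting $\hat r<r$ be maximal with $(\hat r,c)$ empty, there is a ghost cell $\langle r^*,c\rangle$ with $\hat r<r^*<r$, then $\mathcal{G}(D,r)=D$. Otherwise, with $\hat r<r$ maximal such that $(\hat r,c)$ is empty, $\mathcal{G}(D,r)=(D\setminus\{(r,c)\})\cup\{(\hat r,c),\langle r,c\rangle\}$. $\mathrm{GKD}(D)$ is the set of all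 diagrams obtainable from $D$ by finite (possibly empty) sequences of ghost moves, partially ordered by $D_2\preceq D_1$ iff $D_2$ can be obtained from $D_1$ by a finite (possibly empty) sequence of ghost moves; $\prec$ is the strict relation. -}

module Defs where

open import Data.Nat using (ℕ; _<_; _≤_)
open import Data.Product using (Σ; _×_)
open import Data.Sum using (_⊎_)
open import Relation.Nullary using (¬_)
open import Relation.Binary.PropositionalEquality using (_≡_; _≢_)
open import Relation.Binary.Construct.Closure.ReflexiveTransitive using (Star)

-- Indexing convention: the position (r , c) in Agda (r c : ℕ, starting at 0)
-- stands for the paper's position (r+1 , c+1) in ℤ>0 × ℤ>0.
-- A diagram assigns to each position its content.

data Cell : Set where
  empty ordinary ghost : Cell

-- D r c = content at row r (counted from the bottom), column c
Diagram : Set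
Diagram = ℕ → ℕ → Cell

Finite : Diagram → Set
Finite D = Σ ℕ λ N → ∀ r c → N ≤ r ⊎ N ≤ c → D r c ≡ empty

_≐_ : Diagram → Diagram → Set
D ≐ E = ∀ r c → D r c ≡ E r c

NoGhosts : Diagram → Set
NoGhosts D = ∀ r c → D r c ≢ ghost

RowEmpty : Diagram → ℕ → Set
RowEmpty D r = ∀ c → D r c ≡ empty

Rightmost : Diagram → ℕ → ℕ → Set
Rightmost D r c = D r c ≢ empty × (∀ c' → c < c' → D r c' ≡ empty)

MaxEmptyBelow : Diagram → ℕ → ℕ → ℕ → Set
MaxEmptyBelow D r c r̂ =
  r̂ < r × D r̂ c ≡ empty × (∀ r' → r̂ < r' → r' < r → D r' c ≢ empty)

-- (D ∖ {(r,c)}) ∪ {(r̂,c), ⟨r,c⟩}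
data Moved (D : Diagram) (r c r̂ : ℕ) : ℕ → ℕ → Cell → Set where
  atOld   : Moved D r c r̂ r c ghost
  atNew   : Moved D r c r̂ r̂ c ordinary
  other   : ∀ {a b} → ¬ (a ≡ r × b ≡ c) → ¬ (a ≡ r̂ × b ≡ c) → Moved D r c r̂ a b (D a b)

IsMoved : Diagram → ℕ → ℕ → ℕ → Diagram → Set
IsMoved D r c r̂ D' = ∀ a b → Moved D r c r̂ a b (D' a b)

GhostMove : Diagram → ℕ → Diagram → Set
GhostMove D r D' =
  (RowEmpty D r × D' ≐ D)
  ⊎ Σ ℕ λ c → Rightmost D r c ×
     ( (D r c ≡ ghost × D' ≐ D)
     ⊎ (D r c ≡ ordinary × (∀ r̂ → r̂ < r → D r̂ c ≢ empty) × D' ≐ D)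
     ⊎ (D r c ≡ ordinary × Σ ℕ λ r̂ → MaxEmptyBelow D r c r̂ ×
          Σ ℕ λ r* → r̂ < r* × r* < r × D r* c ≡ ghost × D' ≐ D)
     ⊎ (D r c ≡ ordinary × Σ ℕ λ r̂ → MaxEmptyBelow D r c r̂ ×
          (∀ r* → r̂ < r* → r* < r → D r* c ≢ ghost) × IsMoved D r c r̂ D'))

Step : Diagram → Diagram → Set
Step D D' = Σ ℕ λ r → GhostMove D r D'

_⪯_ : Diagram → Diagram → Set
D₂ ⪯ D₁ = Star Step D₁ D₂

_≺_ : Diagram → Diagram → Set
D₂ ≺ D₁ = D₂ ⪯ D₁ × ¬ (D₂ ≐ D₁)

_∈GKD_ : Diagram → Diagram → Set
T ∈GKD D = T ⪯ D

{-# OPTIONS --safe #-}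
module Submission where

-- A ghost move changes only two positions: the moved ordinary cell becomes a
-- ghost and an empty position becomes ordinary.  Hence ghost cells persist, and
-- ordinary cells stay ordinary or turn into ghosts.  A cell at row r of a run of
-- ordinary cells sitting directly above a ghost at row r₁ can never move: the
-- highest empty position below it lies below r₁, so the ghost at r₁ blocks the
-- move.  Neither part needs the hypotheses on D; both are invariants of
-- arbitrary sequences of ghost moves.

open import Defs
open import Data.Nat using (ℕ; _<_; _≤_)
open import Data.Nat.Properties using (_<?_; ≮⇒≥; m≤n⇒m<n∨m≡n; <⇒≤; ≤-trans; ≤-refl)
open import Data.Product using (_×_; _,_; proj₁; proj₂)
open import Data.Sum using (_⊎_; inj₁; inj₂)
open import Data.Empty using (⊥-elim)
open import Relation.Nullary using (¬_; yes; no)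
open import Relation.Binary.PropositionalEquality using (_≡_; _≢_; refl; trans)
open import Relation.Binary.Construct.Closure.ReflexiveTransitive using (ε; _◅_)

ordinary-nonEmpty : ∀ {x} → x ≡ ordinary → x ≢ empty
ordinary-nonEmpty refl ()

ghost-nonEmpty : ∀ {x} → x ≡ ghost → x ≢ empty
ghost-nonEmpty refl ()

record ProperMove (D : Diagram) (r : ℕ) (D' : Diagram) : Set where
  field
    col r̂ : ℕ
    maxEmptyBelow  : MaxEmptyBelow D r col r̂
    noGhostBetween : ∀ r* → r̂ < r* → r* < r → D r* col ≢ ghost
    moved          : IsMoved D r col r̂ D'

ghostMove-trivial-or-proper : ∀ {D r D'} → GhostMove D r D' → D' ≐ D ⊎ ProperMove D r D'
ghostMove-trivial-or-proper (inj₁ (_ , D'≐D)) = inj₁ D'≐D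
ghostMove-trivial-or-proper (inj₂ (_ , _ , inj₁ (_ , D'≐D))) = inj₁ D'≐D
ghostMove-trivial-or-proper (inj₂ (_ , _ , inj₂ (inj₁ (_ , _ , D'≐D)))) = inj₁ D'≐D
ghostMove-trivial-or-proper (inj₂ (_ , _ , inj₂ (inj₂ (inj₁ (_ , _ , _ , _ , _ , _ , _ , D'≐D))))) =
  inj₁ D'≐D
ghostMove-trivial-or-proper (inj₂ (c , _ , inj₂ (inj₂ (inj₂ (_ , r̂ , max , between , mv))))) =
  inj₂ (record { col = c ; r̂ = r̂ ; maxEmptyBelow = max ; noGhostBetween = between ; moved = mv })

moved-nonEmpty : ∀ {D r c r̂ a b x} → D r̂ c ≡ empty → Moved D r c r̂ a b x → D a b ≢ empty →
  x ≡ D a b ⊎ (a ≡ r × b ≡ c × x ≡ ghost)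
moved-nonEmpty _ atOld _ = inj₂ (refl , refl , refl)
moved-nonEmpty vacated atNew nonEmpty with nonEmpty vacated
... | ()
moved-nonEmpty _ (other _ _) _ = inj₁ refl

properMove-nonEmpty : ∀ {D r D' a b} (m : ProperMove D r D') → D a b ≢ empty →
  D' a b ≡ D a b ⊎ (a ≡ r × b ≡ ProperMove.col m × D' a b ≡ ghost)
properMove-nonEmpty {a = a} {b} m =
  moved-nonEmpty (proj₁ (proj₂ maxEmptyBelow)) (moved a b)
  where open ProperMove m

preserved-by-⪯ : (P : Diagram → Set) →
  (∀ {D D'} → D' ≐ D → P D → P D') →
  (∀ {D r D'} → ProperMove D r D' → P D → P D') →
  ∀ {T T̃} → T̃ ⪯ T → P T → P T̃
preserved-by-⪯ P resp proper ε p = p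
preserved-by-⪯ P resp proper ((_ , move) ◅ moves) p =
  preserved-by-⪯ P resp proper moves (step (ghostMove-trivial-or-proper move))
  where
  step : ∀ {D'} → D' ≐ _ ⊎ ProperMove _ _ D' → P D'
  step (inj₁ D'≐D) = resp D'≐D p
  step (inj₂ m)    = proper m p

properMove-ghost : ∀ {D r D' a b} → ProperMove D r D' → D a b ≡ ghost → D' a b ≡ ghost
properMove-ghost m g with properMove-nonEmpty m (ghost-nonEmpty g)
... | inj₁ kept         = trans kept g
... | inj₂ (_ , _ , g') = g'

ordinary-persists-or-ghost : ∀ {T T̃} a b → T̃ ⪯ T → T a b ≡ ordinary →
  T̃ a b ≡ ordinary ⊎ T̃ a b ≡ ghost
ordinary-persists-or-ghost a b T̃⪯T o = preserved-by-⪯ OrdinaryOrGhost resp proper T̃⪯T (inj₁ o)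
  where
  OrdinaryOrGhost : Diagram → Set
  OrdinaryOrGhost D = D a b ≡ ordinary ⊎ D a b ≡ ghost

  resp : ∀ {D D'} → D' ≐ D → OrdinaryOrGhost D → OrdinaryOrGhost D'
  resp D'≐D (inj₁ o) = inj₁ (trans (D'≐D a b) o)
  resp D'≐D (inj₂ g) = inj₂ (trans (D'≐D a b) g)

  proper : ∀ {D r D'} → ProperMove D r D' → OrdinaryOrGhost D → OrdinaryOrGhost D'
  proper m (inj₁ o) with properMove-nonEmpty m (ordinary-nonEmpty o)
  ... | inj₁ kept         = inj₁ (trans kept o)
  ... | inj₂ (_ , _ , g') = inj₂ g'
  proper m (inj₂ g) = inj₂ (properMove-ghost m g)

GhostBelowRun : ℕ → ℕ → ℕ → Diagram → Set
GhostBelowRun c r₁ r₂ T = T r₁ c ≡ ghost × (∀ r̃ → r₁ < r̃ → r̃ ≤ r₂ → T r̃ c ≡ ordinary)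

ghostBelowRun-nonEmpty : ∀ {D c r₁ r₂ r} → GhostBelowRun c r₁ r₂ D → r₁ ≤ r → r ≤ r₂ → D r c ≢ empty
ghostBelowRun-nonEmpty (g , run) r₁≤r r≤r₂ with m≤n⇒m<n∨m≡n r₁≤r
... | inj₁ r₁<r = ordinary-nonEmpty (run _ r₁<r r≤r₂)
... | inj₂ refl = ghost-nonEmpty g

ghostBelowRun-blocks : ∀ {D c r₁ r₂ r r̂} → GhostBelowRun c r₁ r₂ D → r₁ < r → r ≤ r₂ →
  MaxEmptyBelow D r c r̂ → ¬ (∀ r* → r̂ < r* → r* < r → D r* c ≢ ghost)
ghostBelowRun-blocks {D} {r₁ = r₁} {r̂ = r̂} run r₁<r r≤r₂ (r̂<r , emptyAtr̂ , _) noGhost with r̂ <? r₁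
... | yes r̂<r₁ = noGhost r₁ r̂<r₁ r₁<r (proj₁ run)
... | no r̂≮r₁  = ghostBelowRun-nonEmpty {D} run (≮⇒≥ r̂≮r₁) (≤-trans (<⇒≤ r̂<r) r≤r₂) emptyAtr̂

ghostBelowRun-persists : ∀ {T T̃} c r₁ r₂ → T̃ ⪯ T → GhostBelowRun c r₁ r₂ T → GhostBelowRun c r₁ r₂ T̃
ghostBelowRun-persists c r₁ r₂ = preserved-by-⪯ (GhostBelowRun c r₁ r₂) resp proper
  where
  resp : ∀ {D D'} → D' ≐ D → GhostBelowRun c r₁ r₂ D → GhostBelowRun c r₁ r₂ D'
  resp D'≐D (g , run) = trans (D'≐D r₁ c) g , λ r̃ r₁<r̃ r̃≤r₂ → trans (D'≐D r̃ c) (run r̃ r₁<r̃ r̃≤r₂)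

  proper : ∀ {D r D'} → ProperMove D r D' → GhostBelowRun c r₁ r₂ D → GhostBelowRun c r₁ r₂ D'
  proper {D} {D' = D'} m inv@(g , run) = properMove-ghost m g , stays
    where
    open ProperMove m
    stays : ∀ r̃ → r₁ < r̃ → r̃ ≤ r₂ → D' r̃ c ≡ ordinary
    stays r̃ r₁<r̃ r̃≤r₂ with properMove-nonEmpty m (ordinary-nonEmpty (run r̃ r₁<r̃ r̃≤r₂))
    ... | inj₁ kept = trans kept (run r̃ r₁<r̃ r̃≤r₂)
    ... | inj₂ (refl , refl , _) =
      ⊥-elim (ghostBelowRun-blocks {D} inv r₁<r̃ r̃≤r₂ maxEmptyBelow noGhostBetween)

lemma3p6 : (D : Diagram) → Finite D → NoGhosts D → (T : Diagram) → T ∈GKD D →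
    ((r c : ℕ) → T r c ≡ ordinary → (T̃ : Diagram) → T̃ ∈GKD D → T̃ ≺ T →
        T̃ r c ≡ ordinary ⊎ T̃ r c ≡ ghost)
  × ((c r₁ r₂ : ℕ) → r₁ < r₂ → T r₁ c ≡ ghost →
        (∀ r̃ → r₁ < r̃ → r̃ ≤ r₂ → T r̃ c ≡ ordinary) →
        (T̃ : Diagram) → T̃ ⪯ T → T̃ r₂ c ≡ ordinary)
lemma3p6 _ _ _ _ _ =
    (λ r c o _ _ (T̃⪯T , _) → ordinary-persists-or-ghost r c T̃⪯T o)
  , (λ c r₁ r₂ r₁<r₂ g run _ T̃⪯T →
       proj₂ (ghostBelowRun-persists c r₁ r₂ T̃⪯T (g , run)) r₂ r₁<r₂ ≤-refl)
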